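{- Let $0<\ell<\omega$ and let $\mathcal{B}\subseteq {}^\ell 2$ be a linearly independent set of vectors in the vector space $({}^\ell 2,+,\cdot)$ over the two-element field $(\{0,1\},+_2,\cdot_2)$ (addition being coordinatewise modulo 2). For sets $X,Y\subseteq {}^\ell 2$ write $X+Y=\{x+y:x\in X,\ y\in Y\}$, and $X+z=\{x+z:x\in X\}$. (a) If $a,b,c\in {}^\ell 2$ are pairwise distinct and $\{a,b,c\}+\{a,b,c\}\subseteq \mathcal{B}+\mathcal{B}$, then there are pairwise distinct $\eta,\nu,\rho\in\mathcal{B}$ such that $a+b=\eta+\nu$ and $a+c=\eta+\rho$. (b) If $\mathcal{A}\subseteq {}^\ell 2$, $|\mathcal{A}|\geq 5$ and $\mathcal{A}+\mathcal{A}\subseteq \mathcal{B}+\mathcal{B}$, then there is a unique $x\in {}^\ell 2$ such that $\mathcal{A}+x\subseteq\mathcal{B}$.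
   Context: ${}^\ell 2$ is the set of $0$–$1$ sequences of length $\ell$, regarded as a vector space over the two-element field with coordinatewise addition modulo 2. -}

module Defs where

open import Level using (0ℓ)
open import Data.Bool using (Bool; false; true; _xor_)
open import Data.Nat using (ℕ)
open import Data.Vec using (Vec; replicate; zipWith; foldr)
open import Data.List using (List; []; _∷_)
open import Data.List.Relation.Unary.All using (All)
open import Data.List.Relation.Unary.Unique.Propositional using (Unique)
open import Data.Product using (Σ; ∃; ∃-syntax; _×_; _,_)
open import Data.Sum using (_⊎_)
open import Relation.Unary using (Pred; _∈_; _⊆_)
open import Relation.Binary.PropositionalEquality using (_≡_)

-- ^ℓ 2 : 0-1 sequences of length ℓ (false = 0, true = 1)
V : ℕ → Set
V ℓ = Vec Bool ℓ

_⊕_ : ∀ {ℓ} → V ℓ → V ℓ → V ℓ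
_⊕_ = zipWith _xor_

infixl 6 _⊕_

𝟎 : ∀ {ℓ} → V ℓ
𝟎 = replicate _ false

Σᵥ : ∀ {ℓ} → List (V ℓ) → V ℓ
Σᵥ [] = 𝟎
Σᵥ (x ∷ xs) = x ⊕ Σᵥ xs

VSet : ℕ → Set₁
VSet ℓ = Pred (V ℓ) 0ℓ

_+ˢ_ : ∀ {ℓ} → VSet ℓ → VSet ℓ → VSet ℓ
(X +ˢ Y) z = ∃[ x ] ∃[ y ] (x ∈ X × y ∈ Y × z ≡ x ⊕ y)

_+ᵖ_ : ∀ {ℓ} → VSet ℓ → V ℓ → VSet ℓ
(X +ᵖ z) w = ∃[ x ] (x ∈ X × w ≡ x ⊕ z)

⟦_,_,_⟧ : ∀ {ℓ} → V ℓ → V ℓ → V ℓ → VSet ℓ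
⟦ a , b , c ⟧ v = v ≡ a ⊎ v ≡ b ⊎ v ≡ c

-- Over GF(2) a linear
-- combination with nonzero coefficients is exactly a sum of distinct elements,
-- so: any list of pairwise distinct elements of B summing to 0 is empty.
LinIndep : ∀ {ℓ} → VSet ℓ → Set
LinIndep {ℓ} B = ∀ (xs : List (V ℓ)) → Unique xs → All (_∈ B) xs →
                 Σᵥ xs ≡ 𝟎 → xs ≡ []

-- Linear independence makes the sum of a duplicate-free list of elements of B determine the
-- list up to order; so a nonzero element of B + B is η + ν for exactly one pair {η, ν}, and
-- the sum of two disjoint such pairs is never a third one.
-- (a) Since (a + b) + (a + c) = b + c, the pairs representing a + b and a + c must meet.
-- (b) Fix a₁ ∈ A. By (a) the pairs of a₁ + a (a ∈ A, a ≠ a₁) meet pairwise. Applied to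
-- a₂, a₃ this gives a hub η with spokes a₁ + aᵢ = η + νᵢ. A pair meeting both spokes but
-- avoiding η is {ν₂, ν₃}, and at most one of a₄, a₅ can have it; the other yields a third
-- spoke. A pair meeting three spokes must contain η, so every a₁ + a is η + (something in B),
-- i.e. A + (a₁ + η) ⊆ B. Two different translates x, y would force a₁ + a₂ = x + y = a₁ + a₃.

module Submission where

open import Defs
open import Level using (Level; 0ℓ)
open import Algebra.Bundles using (CommutativeSemigroup)
import Algebra.Properties.CommutativeSemigroup as CommutativeSemigroupProperties
open import Data.Bool.Properties as Bool
  using (xor-assoc; xor-comm; xor-identityˡ; xor-identityʳ; xor-same)
open import Data.Empty using (⊥-elim)
open import Function using (_∘_)
open import Data.List using (List; []; _∷_; _++_)
open import Data.List.Membership.Propositional using () renaming (_∈_ to _∈ₗ_)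
import Data.List.Membership.DecPropositional as DecMembership
open import Data.List.Membership.Propositional.Properties using (∈-∃++)
open import Data.List.Relation.Binary.Permutation.Propositional
  using (_↭_; refl; prep; swap; trans; ↭-sym; ↭-trans; ↭⇒↭ₛ)
open import Data.List.Relation.Binary.Permutation.Propositional.Properties
  using (shift; All-resp-↭; ∈-resp-↭; ↭-length)
import Data.List.Relation.Binary.Permutation.Setoid.Properties as PermutationSetoidProperties
open import Data.List.Relation.Unary.All using (All; []; _∷_)
open import Data.List.Relation.Unary.All.Properties using (¬Any⇒All¬; All¬⇒¬Any)
open import Data.List.Relation.Unary.AllPairs using ([]; _∷_)
open import Data.List.Relation.Unary.Any using (here; there)
open import Data.List.Relation.Unary.Unique.Propositional using (Unique)
open import Data.Nat using (ℕ; _<_)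
open import Data.Product using (Σ-syntax; ∃; ∃-syntax; _×_; _,_)
open import Data.Sum using (_⊎_; inj₁; inj₂)
open import Data.Vec using ([]; _∷_)
open import Data.Vec.Properties
  using (zipWith-assoc; zipWith-comm; zipWith-identityˡ; zipWith-identityʳ; ≡-dec)
open import Relation.Binary.Definitions using (DecidableEquality)
open import Relation.Binary.PropositionalEquality
  using (_≡_; _≢_; refl; sym; cong; cong₂; subst; setoid; module ≡-Reasoning)
  renaming (trans to ≡-trans)
open import Relation.Binary.PropositionalEquality.Algebra using (isMagma)
open import Relation.Nullary using (yes; no)
open import Relation.Unary using (_∈_; _⊆_)

private
  variable
    a : Level
    X : Set a
    ℓ : ℕ

⊕-assoc : (x y z : V ℓ) → (x ⊕ y) ⊕ z ≡ x ⊕ (y ⊕ z)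
⊕-assoc = zipWith-assoc xor-assoc

⊕-comm : (x y : V ℓ) → x ⊕ y ≡ y ⊕ x
⊕-comm = zipWith-comm xor-comm

⊕-identityˡ : (x : V ℓ) → 𝟎 ⊕ x ≡ x
⊕-identityˡ = zipWith-identityˡ xor-identityˡ

⊕-identityʳ : (x : V ℓ) → x ⊕ 𝟎 ≡ x
⊕-identityʳ = zipWith-identityʳ xor-identityʳ

⊕-self : (x : V ℓ) → x ⊕ x ≡ 𝟎
⊕-self []      = refl
⊕-self (b ∷ x) = cong₂ _∷_ (xor-same b) (⊕-self x)

⊕-commutativeSemigroup : ℕ → CommutativeSemigroup 0ℓ 0ℓ
⊕-commutativeSemigroup ℓ = record
  { isCommutativeSemigroup = record
    { isSemigroup = record { isMagma = isMagma (_⊕_ {ℓ}) ; assoc = ⊕-assoc }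
    ; comm        = ⊕-comm
    }
  }

module _ {ℓ : ℕ} where
  open CommutativeSemigroupProperties (⊕-commutativeSemigroup ℓ) public
    using (interchange; x∙yz≈y∙xz)

_≟_ : DecidableEquality (V ℓ)
_≟_ = ≡-dec Bool._≟_

x⊕[x⊕y]≡y : (x y : V ℓ) → x ⊕ (x ⊕ y) ≡ y
x⊕[x⊕y]≡y x y = begin
  x ⊕ (x ⊕ y) ≡⟨ ⊕-assoc x x y ⟨
  (x ⊕ x) ⊕ y ≡⟨ cong (_⊕ y) (⊕-self x) ⟩
  𝟎 ⊕ y       ≡⟨ ⊕-identityˡ y ⟩
  y           ∎
  where open ≡-Reasoning

x⊕y≡z⇒y≡x⊕z : {x y z : V ℓ} → x ⊕ y ≡ z → y ≡ x ⊕ z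
x⊕y≡z⇒y≡x⊕z {x = x} {y} refl = sym (x⊕[x⊕y]≡y x y)

⊕-cancelˡ : (x : V ℓ) {y z : V ℓ} → x ⊕ y ≡ x ⊕ z → y ≡ z
⊕-cancelˡ x {z = z} eq = ≡-trans (x⊕y≡z⇒y≡x⊕z eq) (x⊕[x⊕y]≡y x z)

x⊕y≡𝟎⇒x≡y : {x y : V ℓ} → x ⊕ y ≡ 𝟎 → x ≡ y
x⊕y≡𝟎⇒x≡y {x = x} eq = sym (⊕-cancelˡ x (≡-trans eq (sym (⊕-self x))))

[x⊕y]⊕y≡x : (x y : V ℓ) → (x ⊕ y) ⊕ y ≡ x
[x⊕y]⊕y≡x x y = ≡-trans (⊕-comm (x ⊕ y) y) (≡-trans (cong (y ⊕_) (⊕-comm x y)) (x⊕[x⊕y]≡y y x))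

⊕-cancelʳ : (x : V ℓ) {y z : V ℓ} → y ⊕ x ≡ z ⊕ x → y ≡ z
⊕-cancelʳ x {y} {z} eq = ⊕-cancelˡ x (≡-trans (⊕-comm x y) (≡-trans eq (⊕-comm z x)))

x≢y⇒x⊕y≢𝟎 : {x y : V ℓ} → x ≢ y → x ⊕ y ≢ 𝟎
x≢y⇒x⊕y≢𝟎 x≢y = x≢y ∘ x⊕y≡𝟎⇒x≡y

summands-distinct : {x y z w : V ℓ} → x ≢ y → x ⊕ y ≡ z ⊕ w → z ≢ w
summands-distinct {z = z} x≢y eq z≡w =
  x≢y⇒x⊕y≢𝟎 x≢y (≡-trans eq (≡-trans (cong (z ⊕_) (sym z≡w)) (⊕-self z)))

[x⊕y]⊕[x⊕z]≡y⊕z : (x y z : V ℓ) → (x ⊕ y) ⊕ (x ⊕ z) ≡ y ⊕ z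
[x⊕y]⊕[x⊕z]≡y⊕z x y z = begin
  (x ⊕ y) ⊕ (x ⊕ z) ≡⟨ interchange x y x z ⟩
  (x ⊕ x) ⊕ (y ⊕ z) ≡⟨ cong (_⊕ (y ⊕ z)) (⊕-self x) ⟩
  𝟎 ⊕ (y ⊕ z)       ≡⟨ ⊕-identityˡ (y ⊕ z) ⟩
  y ⊕ z             ∎
  where open ≡-Reasoning

[x⊕z]⊕[y⊕z]≡x⊕y : (x y z : V ℓ) → (x ⊕ z) ⊕ (y ⊕ z) ≡ x ⊕ y
[x⊕z]⊕[y⊕z]≡x⊕y x y z = begin
  (x ⊕ z) ⊕ (y ⊕ z) ≡⟨ cong₂ _⊕_ (⊕-comm x z) (⊕-comm y z) ⟩
  (z ⊕ x) ⊕ (z ⊕ y) ≡⟨ [x⊕y]⊕[x⊕z]≡y⊕z z x y ⟩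
  x ⊕ y             ∎
  where open ≡-Reasoning

Σᵥ-↭ : {xs ys : List (V ℓ)} → xs ↭ ys → Σᵥ xs ≡ Σᵥ ys
Σᵥ-↭ refl         = refl
Σᵥ-↭ (prep x σ)   = cong (x ⊕_) (Σᵥ-↭ σ)
Σᵥ-↭ (swap x y σ) = ≡-trans (x∙yz≈y∙xz x y _) (cong (λ s → y ⊕ (x ⊕ s)) (Σᵥ-↭ σ))
Σᵥ-↭ (trans σ τ)  = ≡-trans (Σᵥ-↭ σ) (Σᵥ-↭ τ)

Σᵥ-pair : (x y : V ℓ) → Σᵥ (x ∷ y ∷ []) ≡ x ⊕ y
Σᵥ-pair x y = cong (x ⊕_) (⊕-identityʳ y)

Σᵥ-quadruple : (w x y z : V ℓ) → Σᵥ (w ∷ x ∷ y ∷ z ∷ []) ≡ (w ⊕ x) ⊕ (y ⊕ z)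
Σᵥ-quadruple w x y z = ≡-trans (cong (λ s → w ⊕ (x ⊕ s)) (Σᵥ-pair y z)) (sym (⊕-assoc w x (y ⊕ z)))

∈⇒↭∷ : {x : X} {xs : List X} → x ∈ₗ xs → ∃ λ ys → xs ↭ x ∷ ys
∈⇒↭∷ x∈xs with ys₁ , ys₂ , refl ← ∈-∃++ x∈xs = ys₁ ++ ys₂ , shift _ ys₁ ys₂

Unique-resp-↭ : {xs ys : List X} → xs ↭ ys → Unique xs → Unique ys
Unique-resp-↭ σ = PermutationSetoidProperties.Unique-resp-↭ (setoid _) (↭⇒↭ₛ σ)

∈-pair : {x y z : X} → x ∈ₗ y ∷ z ∷ [] → x ≡ y ⊎ x ≡ z
∈-pair (here x≡y)         = inj₁ x≡y
∈-pair (there (here x≡z)) = inj₂ x≡z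

AtLeastFive : VSet ℓ → Set
AtLeastFive {ℓ} A = ∃[ a₁ ] ∃[ a₂ ] ∃[ a₃ ] ∃[ a₄ ] ∃[ a₅ ]
  (a₁ ∈ A × a₂ ∈ A × a₃ ∈ A × a₄ ∈ A × a₅ ∈ A ×
   a₁ ≢ a₂ × a₁ ≢ a₃ × a₁ ≢ a₄ × a₁ ≢ a₅ × a₂ ≢ a₃ × a₂ ≢ a₄ × a₂ ≢ a₅ ×
   a₃ ≢ a₄ × a₃ ≢ a₅ × a₄ ≢ a₅)

module LinearlyIndependent {B : VSet ℓ} (indep : LinIndep B) where

  open DecMembership (_≟_ {ℓ}) using (_∈?_)

  Σᵥ-injective : {xs ys : List (V ℓ)} → Unique xs → Unique ys →
                 All (_∈ B) xs → All (_∈ B) ys → Σᵥ xs ≡ Σᵥ ys → xs ↭ ys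
  Σᵥ-injective {xs = []} _ !ys _ ys∈B eq with refl ← indep _ !ys ys∈B (sym eq) = refl
  Σᵥ-injective {xs = x ∷ xs} {ys} (x∉xs ∷ !xs) !ys (x∈B ∷ xs∈B) ys∈B eq with x ∈? ys
  ... | yes x∈ys = cancel (∈⇒↭∷ x∈ys)
    where
    cancel : ∃ (λ ys′ → ys ↭ x ∷ ys′) → x ∷ xs ↭ ys
    cancel (ys′ , σ) with Unique-resp-↭ σ !ys | All-resp-↭ σ ys∈B
    ... | _ ∷ !ys′ | _ ∷ ys′∈B =
      ↭-trans (prep x (Σᵥ-injective !xs !ys′ xs∈B ys′∈B (⊕-cancelˡ x (≡-trans eq (Σᵥ-↭ σ)))))
              (↭-sym σ)
  ... | no x∉ys = ⊥-elim (All¬⇒¬Any x∉xs (∈-resp-↭ (↭-sym σ) (here refl)))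
    where
    σ : xs ↭ x ∷ ys
    σ = Σᵥ-injective !xs (¬Any⇒All¬ ys x∉ys ∷ !ys) xs∈B (x∈B ∷ ys∈B) (x⊕y≡z⇒y≡x⊕z eq)

  pair-unique : {u v w z : V ℓ} → u ∈ B → v ∈ B → w ∈ B → z ∈ B → u ≢ v →
                u ⊕ v ≡ w ⊕ z → (u ≡ w × v ≡ z) ⊎ (u ≡ z × v ≡ w)
  pair-unique {u} {v} {w} {z} u∈B v∈B w∈B z∈B u≢v eq =
    match (∈-pair (∈-resp-↭ σ (here refl))) (∈-pair (∈-resp-↭ σ (there (here refl))))
    where
    σ : u ∷ v ∷ [] ↭ w ∷ z ∷ []
    σ = Σᵥ-injective ((u≢v ∷ []) ∷ [] ∷ []) ((summands-distinct u≢v eq ∷ []) ∷ [] ∷ [])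
          (u∈B ∷ v∈B ∷ []) (w∈B ∷ z∈B ∷ [])
          (≡-trans (Σᵥ-pair u v) (≡-trans eq (sym (Σᵥ-pair w z))))
    match : u ≡ w ⊎ u ≡ z → v ≡ w ⊎ v ≡ z → (u ≡ w × v ≡ z) ⊎ (u ≡ z × v ≡ w)
    match (inj₁ u≡w) (inj₁ v≡w) = ⊥-elim (u≢v (≡-trans u≡w (sym v≡w)))
    match (inj₁ u≡w) (inj₂ v≡z) = inj₁ (u≡w , v≡z)
    match (inj₂ u≡z) (inj₁ v≡w) = inj₂ (u≡z , v≡w)
    match (inj₂ u≡z) (inj₂ v≡z) = ⊥-elim (u≢v (≡-trans u≡z (sym v≡z)))

  pairs-meet : {η ν η′ ρ′ σ τ : V ℓ} → η ∈ B → ν ∈ B → η′ ∈ B → ρ′ ∈ B → σ ∈ B → τ ∈ B →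
               η ≢ ν → η′ ≢ ρ′ → σ ≢ τ → σ ⊕ τ ≡ (η ⊕ ν) ⊕ (η′ ⊕ ρ′) →
               (η ≡ η′ ⊎ η ≡ ρ′) ⊎ (ν ≡ η′ ⊎ ν ≡ ρ′)
  pairs-meet {η} {ν} {η′} {ρ′} {σ} {τ} η∈B ν∈B η′∈B ρ′∈B σ∈B τ∈B η≢ν η′≢ρ′ σ≢τ eq
    with η ≟ η′ | η ≟ ρ′ | ν ≟ η′ | ν ≟ ρ′
  ... | yes η≡η′ | _          | _          | _      = inj₁ (inj₁ η≡η′)
  ... | no _     | yes η≡ρ′   | _          | _      = inj₁ (inj₂ η≡ρ′)
  ... | no _     | no _       | yes ν≡η′   | _      = inj₂ (inj₁ ν≡η′)
  ... | no _     | no _       | no _       | yes ν≡ρ′ = inj₂ (inj₂ ν≡ρ′)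
  ... | no η≢η′  | no η≢ρ′    | no ν≢η′    | no ν≢ρ′
    with () ← ↭-length (Σᵥ-injective
      ((σ≢τ ∷ []) ∷ [] ∷ [])
      ((η≢ν ∷ η≢η′ ∷ η≢ρ′ ∷ []) ∷ (ν≢η′ ∷ ν≢ρ′ ∷ []) ∷ (η′≢ρ′ ∷ []) ∷ [] ∷ [])
      (σ∈B ∷ τ∈B ∷ [])
      (η∈B ∷ ν∈B ∷ η′∈B ∷ ρ′∈B ∷ [])
      (≡-trans (Σᵥ-pair σ τ) (≡-trans eq (sym (Σᵥ-quadruple η ν η′ ρ′)))))

  CommonSummand : V ℓ → V ℓ → V ℓ → Set
  CommonSummand a b c = ∃[ η ] ∃[ ν ] ∃[ ρ ] (η ∈ B × ν ∈ B × ρ ∈ B × η ≢ ν × η ≢ ρ × ν ≢ ρ ×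
                          a ⊕ b ≡ η ⊕ ν × a ⊕ c ≡ η ⊕ ρ)

  common-summand-intro : {a b c η ν ρ : V ℓ} → a ≢ b → a ≢ c → b ≢ c →
                         η ∈ B → ν ∈ B → ρ ∈ B →
                         a ⊕ b ≡ η ⊕ ν → a ⊕ c ≡ η ⊕ ρ → CommonSummand a b c
  common-summand-intro {a} {η = η} {ν} {ρ} a≢b a≢c b≢c η∈B ν∈B ρ∈B ab ac =
    η , ν , ρ , η∈B , ν∈B , ρ∈B ,
    summands-distinct a≢b ab , summands-distinct a≢c ac , ν≢ρ , ab , ac
    where
    ν≢ρ : ν ≢ ρ
    ν≢ρ ν≡ρ = b≢c (⊕-cancelˡ a (≡-trans ab (≡-trans (cong (η ⊕_) ν≡ρ) (sym ac))))

  common-summand : {a b c : V ℓ} → a ≢ b → a ≢ c → b ≢ c →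
                   (⟦ a , b , c ⟧ +ˢ ⟦ a , b , c ⟧) ⊆ (B +ˢ B) → CommonSummand a b c
  common-summand {a} {b} {c} a≢b a≢c b≢c sub
    with η , ν , η∈B , ν∈B , ab ← sub (a , b , inj₁ refl , inj₂ (inj₁ refl) , refl)
       | η′ , ρ′ , η′∈B , ρ′∈B , ac ← sub (a , c , inj₁ refl , inj₂ (inj₂ refl) , refl)
       | σ , τ , σ∈B , τ∈B , bc ← sub (b , c , inj₂ (inj₁ refl) , inj₂ (inj₂ refl) , refl)
    with pairs-meet η∈B ν∈B η′∈B ρ′∈B σ∈B τ∈B
           (summands-distinct a≢b ab) (summands-distinct a≢c ac) (summands-distinct b≢c bc)
           (≡-trans (sym bc) (≡-trans (sym ([x⊕y]⊕[x⊕z]≡y⊕z a b c)) (cong₂ _⊕_ ab ac)))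
  ... | inj₁ (inj₁ refl) = common-summand-intro a≢b a≢c b≢c η∈B ν∈B ρ′∈B ab ac
  ... | inj₁ (inj₂ refl) = common-summand-intro a≢b a≢c b≢c η∈B ν∈B η′∈B ab (≡-trans ac (⊕-comm η′ η))
  ... | inj₂ (inj₁ refl) = common-summand-intro a≢b a≢c b≢c ν∈B η∈B ρ′∈B (≡-trans ab (⊕-comm η ν)) ac
  ... | inj₂ (inj₂ refl) = common-summand-intro a≢b a≢c b≢c ν∈B η∈B η′∈B
                             (≡-trans ab (⊕-comm η ν)) (≡-trans ac (⊕-comm η′ ν))

  summands-pair : {v β γ : V ℓ} → v ≢ 𝟎 → β ∈ B → γ ∈ B → β ≢ γ →
                  v ∈ B +ᵖ β → v ∈ B +ᵖ γ → v ≡ β ⊕ γ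
  summands-pair {β = β} {γ} v≢𝟎 β∈B γ∈B β≢γ (κ , κ∈B , v≡κ⊕β) (κ′ , κ′∈B , v≡κ′⊕γ)
    with pair-unique κ∈B β∈B κ′∈B γ∈B
           (λ κ≡β → v≢𝟎 (≡-trans v≡κ⊕β (≡-trans (cong (_⊕ β) κ≡β) (⊕-self β))))
           (≡-trans (sym v≡κ⊕β) v≡κ′⊕γ)
  ... | inj₁ (_ , β≡γ) = ⊥-elim (β≢γ β≡γ)
  ... | inj₂ (κ≡γ , _) = ≡-trans v≡κ⊕β (≡-trans (cong (_⊕ β) κ≡γ) (⊕-comm γ β))

  translates-agree : {A : VSet ℓ} {p q x y : V ℓ} → p ∈ A → q ∈ A → p ≢ q →
                     (A +ᵖ x) ⊆ B → (A +ᵖ y) ⊆ B → x ≡ y ⊎ p ⊕ q ≡ x ⊕ y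
  translates-agree {p = p} {q} {x} {y} p∈A q∈A p≢q A+x⊆B A+y⊆B
    with pair-unique (A+x⊆B (p , p∈A , refl)) (A+x⊆B (q , q∈A , refl))
                     (A+y⊆B (p , p∈A , refl)) (A+y⊆B (q , q∈A , refl))
                     (p≢q ∘ ⊕-cancelʳ x)
                     (≡-trans ([x⊕z]⊕[y⊕z]≡x⊕y p q x) (sym ([x⊕z]⊕[y⊕z]≡x⊕y p q y)))
  ... | inj₁ (p⊕x≡p⊕y , _) = inj₁ (⊕-cancelˡ p p⊕x≡p⊕y)
  ... | inj₂ (p⊕x≡q⊕y , _) = inj₂ (begin
    p ⊕ q             ≡⟨ [x⊕z]⊕[y⊕z]≡x⊕y p q x ⟨
    (p ⊕ x) ⊕ (q ⊕ x) ≡⟨ cong (_⊕ (q ⊕ x)) p⊕x≡q⊕y ⟩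
    (q ⊕ y) ⊕ (q ⊕ x) ≡⟨ [x⊕y]⊕[x⊕z]≡y⊕z q y x ⟩
    y ⊕ x             ≡⟨ ⊕-comm y x ⟩
    x ⊕ y             ∎)
    where open ≡-Reasoning

  translation-unique : {A : VSet ℓ} {a₁ a₂ a₃ x y : V ℓ} → a₁ ∈ A → a₂ ∈ A → a₃ ∈ A →
                       a₁ ≢ a₂ → a₁ ≢ a₃ → a₂ ≢ a₃ → (A +ᵖ x) ⊆ B → (A +ᵖ y) ⊆ B → x ≡ y
  translation-unique a₁∈A a₂∈A a₃∈A a₁≢a₂ a₁≢a₃ a₂≢a₃ A+x⊆B A+y⊆B
    with translates-agree a₁∈A a₂∈A a₁≢a₂ A+x⊆B A+y⊆B
       | translates-agree a₁∈A a₃∈A a₁≢a₃ A+x⊆B A+y⊆B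
  ... | inj₁ x≡y | _        = x≡y
  ... | inj₂ _   | inj₁ x≡y = x≡y
  ... | inj₂ e₂  | inj₂ e₃  = ⊥-elim (a₂≢a₃ (⊕-cancelˡ _ (≡-trans e₂ (sym e₃))))

  module _ {A : VSet ℓ} (A+A⊆B+B : (A +ˢ A) ⊆ (B +ˢ B)) where

    common-summand-in : {p q r : V ℓ} → p ∈ A → q ∈ A → r ∈ A →
                        p ≢ q → p ≢ r → q ≢ r → CommonSummand p q r
    common-summand-in {p} {q} {r} p∈A q∈A r∈A p≢q p≢r q≢r =
      common-summand p≢q p≢r q≢r λ (x , y , x∈ , y∈ , eq) → A+A⊆B+B (x , y , ∈A x∈ , ∈A y∈ , eq)
      where
      ∈A : {v : V ℓ} → v ∈ ⟦ p , q , r ⟧ → v ∈ A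
      ∈A (inj₁ refl)        = p∈A
      ∈A (inj₂ (inj₁ refl)) = q∈A
      ∈A (inj₂ (inj₂ refl)) = r∈A

    record Spoke (a₁ η : V ℓ) : Set where
      field
        point     : V ℓ
        point∈A   : point ∈ A
        a₁≢point  : a₁ ≢ point
        partner   : V ℓ
        partner∈B : partner ∈ B
        sum≡      : a₁ ⊕ point ≡ partner ⊕ η

    open Spoke

    partner-injective : {a₁ η : V ℓ} (s t : Spoke a₁ η) → partner s ≡ partner t → point s ≡ point t
    partner-injective s t eq =
      ⊕-cancelˡ _ (≡-trans (sum≡ s) (≡-trans (cong (_⊕ _) eq) (sym (sum≡ t))))

    neighbour-summand : {a₁ η a : V ℓ} → a₁ ∈ A → η ∈ B → (s : Spoke a₁ η) → a ∈ A → a₁ ≢ a →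
                        a₁ ⊕ a ∈ B +ᵖ η ⊎ a₁ ⊕ a ∈ B +ᵖ partner s
    neighbour-summand {a = a} a₁∈A η∈B s a∈A a₁≢a with point s ≟ a
    ... | yes refl = inj₁ (partner s , partner∈B s , sum≡ s)
    ... | no p≢a
      with ζ , μ , κ , ζ∈B , μ∈B , κ∈B , _ , _ , _ , e₁ , e₂
             ← common-summand-in a₁∈A (point∈A s) a∈A (a₁≢point s) a₁≢a p≢a
      with pair-unique (partner∈B s) η∈B ζ∈B μ∈B
             (summands-distinct (a₁≢point s) (sum≡ s)) (≡-trans (sym (sum≡ s)) e₁)
    ... | inj₁ (refl , _) = inj₂ (κ , κ∈B , ≡-trans e₂ (⊕-comm _ κ))
    ... | inj₂ (_ , refl) = inj₁ (κ , κ∈B , ≡-trans e₂ (⊕-comm _ κ))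

    spoke-from : {a₁ η ν a : V ℓ} → a ∈ A → a₁ ≢ a → ν ∈ B → a₁ ⊕ a ≡ η ⊕ ν → Spoke a₁ η
    spoke-from {η = η} {ν} a∈A a₁≢a ν∈B eq = record
      { point = _ ; point∈A = a∈A ; a₁≢point = a₁≢a
      ; partner = ν ; partner∈B = ν∈B ; sum≡ = ≡-trans eq (⊕-comm η ν) }

    spoke-or-opposite : {a₁ η a : V ℓ} → a₁ ∈ A → η ∈ B → (s t : Spoke a₁ η) → partner s ≢ partner t →
                        a ∈ A → a₁ ≢ a → a₁ ⊕ a ∈ B +ᵖ η ⊎ a₁ ⊕ a ≡ partner s ⊕ partner t
    spoke-or-opposite a₁∈A η∈B s t s≢t a∈A a₁≢a
      with neighbour-summand a₁∈A η∈B s a∈A a₁≢a | neighbour-summand a₁∈A η∈B t a∈A a₁≢a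
    ... | inj₁ η-summand | _              = inj₁ η-summand
    ... | inj₂ _         | inj₁ η-summand = inj₁ η-summand
    ... | inj₂ via-s     | inj₂ via-t     =
      inj₂ (summands-pair (x≢y⇒x⊕y≢𝟎 a₁≢a) (partner∈B s) (partner∈B t) s≢t via-s via-t)

    three-spokes-summand : {a₁ η a : V ℓ} → a₁ ∈ A → η ∈ B → (s t u : Spoke a₁ η) →
                           partner s ≢ partner t → partner s ≢ partner u → partner t ≢ partner u →
                           a ∈ A → a₁ ≢ a → a₁ ⊕ a ∈ B +ᵖ η
    three-spokes-summand a₁∈A η∈B s t u s≢t s≢u t≢u a∈A a₁≢a
      with spoke-or-opposite a₁∈A η∈B s t s≢t a∈A a₁≢a | spoke-or-opposite a₁∈A η∈B s u s≢u a∈A a₁≢a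
    ... | inj₁ η-summand | _              = η-summand
    ... | inj₂ _         | inj₁ η-summand = η-summand
    ... | inj₂ e         | inj₂ e′        = ⊥-elim (t≢u (⊕-cancelˡ (partner s) (≡-trans (sym e) e′)))

    fresh-spoke : {a₁ η a : V ℓ} (s t : Spoke a₁ η) → a ∈ A → a₁ ≢ a → point s ≢ a → point t ≢ a →
                  a₁ ⊕ a ∈ B +ᵖ η → Σ[ u ∈ Spoke a₁ η ] (partner s ≢ partner u × partner t ≢ partner u)
    fresh-spoke s t a∈A a₁≢a s≢a t≢a (μ , μ∈B , eq) =
      u , s≢a ∘ partner-injective s u , t≢a ∘ partner-injective t u
      where
      u : Spoke _ _
      u = record { point∈A = a∈A ; a₁≢point = a₁≢a ; partner∈B = μ∈B ; sum≡ = eq }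

    third-spoke : {a₁ η a₄ a₅ : V ℓ} → a₁ ∈ A → η ∈ B → (s t : Spoke a₁ η) → partner s ≢ partner t →
                  a₄ ∈ A → a₅ ∈ A → a₁ ≢ a₄ → a₁ ≢ a₅ → a₄ ≢ a₅ →
                  point s ≢ a₄ → point t ≢ a₄ → point s ≢ a₅ → point t ≢ a₅ →
                  Σ[ u ∈ Spoke a₁ η ] (partner s ≢ partner u × partner t ≢ partner u)
    third-spoke a₁∈A η∈B s t s≢t a₄∈A a₅∈A a₁≢a₄ a₁≢a₅ a₄≢a₅ s≢a₄ t≢a₄ s≢a₅ t≢a₅
      with spoke-or-opposite a₁∈A η∈B s t s≢t a₄∈A a₁≢a₄ | spoke-or-opposite a₁∈A η∈B s t s≢t a₅∈A a₁≢a₅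
    ... | inj₁ η-summand | _              = fresh-spoke s t a₄∈A a₁≢a₄ s≢a₄ t≢a₄ η-summand
    ... | inj₂ _         | inj₁ η-summand = fresh-spoke s t a₅∈A a₁≢a₅ s≢a₅ t≢a₅ η-summand
    ... | inj₂ e₄        | inj₂ e₅        = ⊥-elim (a₄≢a₅ (⊕-cancelˡ _ (≡-trans e₄ (sym e₅))))

    three-spokes-translate : {a₁ η : V ℓ} → a₁ ∈ A → η ∈ B → (s t u : Spoke a₁ η) →
                             partner s ≢ partner t → partner s ≢ partner u → partner t ≢ partner u →
                             (A +ᵖ (a₁ ⊕ η)) ⊆ B
    three-spokes-translate {a₁} {η} a₁∈A η∈B s t u s≢t s≢u t≢u (a , a∈A , refl) with a₁ ≟ a
    ... | yes refl = subst (_∈ B) (sym (x⊕[x⊕y]≡y a₁ η)) η∈B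
    ... | no a₁≢a with κ , κ∈B , eq ← three-spokes-summand a₁∈A η∈B s t u s≢t s≢u t≢u a∈A a₁≢a =
      subst (_∈ B) κ≡a⊕[a₁⊕η] κ∈B
      where
      open ≡-Reasoning
      κ≡a⊕[a₁⊕η] : κ ≡ a ⊕ (a₁ ⊕ η)
      κ≡a⊕[a₁⊕η] = begin
        κ               ≡⟨ [x⊕y]⊕y≡x κ η ⟨
        (κ ⊕ η) ⊕ η     ≡⟨ cong (_⊕ η) eq ⟨
        (a₁ ⊕ a) ⊕ η    ≡⟨ ⊕-assoc a₁ a η ⟩
        a₁ ⊕ (a ⊕ η)    ≡⟨ x∙yz≈y∙xz a₁ a η ⟩
        a ⊕ (a₁ ⊕ η)    ∎

    two-spokes-translate : {a₁ η a₄ a₅ : V ℓ} → a₁ ∈ A → η ∈ B → (s t : Spoke a₁ η) →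
                           partner s ≢ partner t → a₄ ∈ A → a₅ ∈ A → a₁ ≢ a₄ → a₁ ≢ a₅ → a₄ ≢ a₅ →
                           point s ≢ a₄ → point t ≢ a₄ → point s ≢ a₅ → point t ≢ a₅ →
                           (A +ᵖ (a₁ ⊕ η)) ⊆ B
    two-spokes-translate a₁∈A η∈B s t s≢t a₄∈A a₅∈A a₁≢a₄ a₁≢a₅ a₄≢a₅ s≢a₄ t≢a₄ s≢a₅ t≢a₅
      with u , s≢u , t≢u ← third-spoke a₁∈A η∈B s t s≢t a₄∈A a₅∈A a₁≢a₄ a₁≢a₅ a₄≢a₅ s≢a₄ t≢a₄ s≢a₅ t≢a₅
      = three-spokes-translate a₁∈A η∈B s t u s≢t s≢u t≢u

    unique-translation : AtLeastFive A → ∃[ x ] ((A +ᵖ x) ⊆ B × ((y : V ℓ) → (A +ᵖ y) ⊆ B → y ≡ x))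
    unique-translation (a₁ , a₂ , a₃ , a₄ , a₅ , a₁∈A , a₂∈A , a₃∈A , a₄∈A , a₅∈A ,
                        a₁≢a₂ , a₁≢a₃ , a₁≢a₄ , a₁≢a₅ , a₂≢a₃ , a₂≢a₄ , a₂≢a₅ , a₃≢a₄ , a₃≢a₅ , a₄≢a₅)
      with η , ν₂ , ν₃ , η∈B , ν₂∈B , ν₃∈B , _ , _ , ν₂≢ν₃ , e₂ , e₃
             ← common-summand-in a₁∈A a₂∈A a₃∈A a₁≢a₂ a₁≢a₃ a₂≢a₃
      = a₁ ⊕ η , A+x⊆B ,
        λ y A+y⊆B → translation-unique a₁∈A a₂∈A a₃∈A a₁≢a₂ a₁≢a₃ a₂≢a₃ A+y⊆B A+x⊆B
      where
      A+x⊆B : (A +ᵖ (a₁ ⊕ η)) ⊆ B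
      A+x⊆B = two-spokes-translate a₁∈A η∈B
                (spoke-from a₂∈A a₁≢a₂ ν₂∈B e₂) (spoke-from a₃∈A a₁≢a₃ ν₃∈B e₃) ν₂≢ν₃
                a₄∈A a₅∈A a₁≢a₄ a₁≢a₅ a₄≢a₅ a₂≢a₄ a₃≢a₄ a₂≢a₅ a₃≢a₅

lemma2p3 : ∀ (ℓ : ℕ) → 0 < ℓ → (B : VSet ℓ) → LinIndep B →
    ((a b c : V ℓ) → a ≢ b → a ≢ c → b ≢ c →
      (⟦ a , b , c ⟧ +ˢ ⟦ a , b , c ⟧) ⊆ (B +ˢ B) →
      ∃[ η ] ∃[ ν ] ∃[ ρ ] (η ∈ B × ν ∈ B × ρ ∈ B × η ≢ ν × η ≢ ρ × ν ≢ ρ ×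
        a ⊕ b ≡ η ⊕ ν × a ⊕ c ≡ η ⊕ ρ))
    ×
    ((A : VSet ℓ) →
      (∃[ a₁ ] ∃[ a₂ ] ∃[ a₃ ] ∃[ a₄ ] ∃[ a₅ ]
        (a₁ ∈ A × a₂ ∈ A × a₃ ∈ A × a₄ ∈ A × a₅ ∈ A ×
         a₁ ≢ a₂ × a₁ ≢ a₃ × a₁ ≢ a₄ × a₁ ≢ a₅ × a₂ ≢ a₃ × a₂ ≢ a₄ × a₂ ≢ a₅ ×
         a₃ ≢ a₄ × a₃ ≢ a₅ × a₄ ≢ a₅)) →
      (A +ˢ A) ⊆ (B +ˢ B) →
      ∃[ x ] ((A +ᵖ x) ⊆ B × ((y : V ℓ) → (A +ᵖ y) ⊆ B → y ≡ x)))
lemma2p3 ℓ _ B indep =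
  (λ a b c → common-summand) , λ A at-least-five A+A⊆B+B → unique-translation A+A⊆B+B at-least-five
  where open LinearlyIndependent indep
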